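{- For every $\varepsilon>0$ there are $\delta=\delta(\varepsilon)>0$ and $C=C(\varepsilon)>0$ such that the following holds for every $m\in\mathbb{N}$. Let $X$ be a set of size $m$ and $\mathcal{F}\subseteq 2^X$ a family of subsets such that $|F|\ge\varepsilon m$ for every $F\in\mathcal{F}$. Then there is some $\mathcal{G}\subseteq\mathcal{F}$ with $|\mathcal{G}|\le C$ and a partition $\mathcal{P}$ of $\mathcal{F}\setminus\mathcal{G}$ into sets of size $4$ such that $|B_1\cap B_2\cap B_3\cap B_4|\ge\delta m$ for every $\{B_1,B_2,B_3,B_4\}\in\mathcal{P}$. -}

module Defs where

open import Data.Nat using (ℕ)
open import Data.Integer using (+_)
open import Data.Rational using (ℚ; _/_; _*_; _≤_)
open import Data.Fin using (Fin)
open import Data.Fin.Subset using (Subset; _∩_; ∣_∣; _∉_)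
open import Data.Fin.Subset.Properties using (_∈?_)
open import Data.List using (List; []; _∷_; concatMap; filter; allFin)
open import Data.List.Relation.Binary.Permutation.Propositional using (_↭_)
open import Data.Product using (_×_; _,_)
open import Relation.Nullary using (¬?)

ℕtoℚ : ℕ → ℚ
ℕtoℚ n = (+ n) / 1

-- an unordered 4-block, given by four indices into the family
Quad : ℕ → Set
Quad k = Fin k × Fin k × Fin k × Fin k

quadList : ∀ {k} → Quad k → List (Fin k)
quadList (a , b , c , d) = a ∷ b ∷ c ∷ d ∷ []

rest : ∀ {k} → Subset k → List (Fin k)
rest {k} G = filter (λ i → ¬? (i ∈? G)) (allFin k)

-- P is a partition of (the indices of) F \ G into 4-element blocks:
-- concatenating the blocks is a permutation of the list of indices outside G
-- (so each block has 4 distinct members and blocks are disjoint and cover F \ G)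
IsQuadPartition : ∀ {k} → Subset k → List (Quad k) → Set
IsQuadPartition G P = concatMap quadList P ↭ rest G

quadInter : ∀ {k m} → (Fin k → Subset m) → Quad k → Subset m
quadInter F (a , b , c , d) = F a ∩ F b ∩ F c ∩ F d

-- Write ε = (a+1)/(b+1) and t = 4(b+1). Any t members of F have sizes summing to at least 4m.
-- Counting every point by the number c of these members containing it, and using c ≤ 3 + C(c,4),
-- that sum is at most 3m plus the sum, over all quadruples among the t members, of the size of
-- their intersection. Hence any t members contain a quadruple meeting in at least m / C(t,4)
-- points. Removing such quadruples greedily until fewer than t members remain leaves the
-- exceptional family G; so |G| ≤ t - 1, and δ = 1 / (C(t,4) + 1) works.
module Submission where

open import Defs

module Counting where

  open import Data.Bool using (Bool; true; false; _∧_; if_then_else_)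
  open import Data.Bool.ListAction using (all)
  open import Data.Fin using (Fin)
  open import Data.Fin.Subset using (Subset; ∣_∣; _∩_; ⋂)
  open import Data.Fin.Subset.Properties using (∩-identityʳ)
  open import Data.List using (List; []; _∷_; _++_; map; length)
  open import Data.List.Properties using (length-++; length-map)
  open import Data.List.Membership.Propositional using (_∈_)
  open import Data.List.Membership.Propositional.Properties using (∈-++⁻; ∈-map⁻)
  open import Data.List.Relation.Unary.Any using (here; there)
  open import Data.List.Relation.Binary.Permutation.Propositional using (_↭_; ↭-refl; ↭-sym; ↭-trans; prep)
  open import Data.List.Relation.Binary.Permutation.Propositional.Properties using (shift)
  open import Data.Nat using (ℕ; zero; suc; _+_; _*_; _≤_; _<_; z≤n; s≤s; _≤?_)
  open import Data.Nat.Combinatorics using (_C_; nCk+nC[k+1]≡[n+1]C[k+1])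
  open import Data.Nat.Properties
  open import Algebra.Properties.CommutativeSemigroup +-commutativeSemigroup using (interchange; x∙yz≈y∙xz)
  open import Data.Product using (Σ; ∃; ∃₂; _×_; _,_; proj₁; proj₂; map₁; map₂)
  open import Data.Sum using (inj₁; inj₂)
  open import Data.Vec using (head; tail) renaming ([] to []ᵥ; _∷_ to _∷ᵥ_)
  open import Function using (_∘_)
  open import Relation.Binary.PropositionalEquality
  open import Relation.Nullary using (yes; no)

  private variable
    X : Set
    k m n : ℕ

  sumOf : (X → ℕ) → List X → ℕ
  sumOf w []       = 0
  sumOf w (x ∷ xs) = w x + sumOf w xs

  sumOf-++ : (w : X → ℕ) (xs ys : List X) → sumOf w (xs ++ ys) ≡ sumOf w xs + sumOf w ys
  sumOf-++ w []       ys = refl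
  sumOf-++ w (x ∷ xs) ys = trans (cong (w x +_) (sumOf-++ w xs ys)) (sym (+-assoc (w x) _ _))

  sumOf-map : {Y : Set} (w : Y → ℕ) (g : X → Y) (xs : List X) → sumOf w (map g xs) ≡ sumOf (λ x → w (g x)) xs
  sumOf-map w g []       = refl
  sumOf-map w g (x ∷ xs) = cong (w (g x) +_) (sumOf-map w g xs)

  sumOf-+ : (v w : X → ℕ) (xs : List X) → sumOf (λ x → v x + w x) xs ≡ sumOf v xs + sumOf w xs
  sumOf-+ v w []       = refl
  sumOf-+ v w (x ∷ xs) = trans (cong (v x + w x +_) (sumOf-+ v w xs)) (interchange (v x) (w x) (sumOf v xs) (sumOf w xs))

  sumOf-cong : {v w : X → ℕ} → (∀ x → v x ≡ w x) → (xs : List X) → sumOf v xs ≡ sumOf w xs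
  sumOf-cong v≡w []       = refl
  sumOf-cong v≡w (x ∷ xs) = cong₂ _+_ (v≡w x) (sumOf-cong v≡w xs)

  sumOf-0 : (xs : List X) → sumOf (λ _ → 0) xs ≡ 0
  sumOf-0 []       = refl
  sumOf-0 (x ∷ xs) = sumOf-0 xs

  length*≤*sumOf : ∀ {m} c (w : X → ℕ) → (∀ x → m ≤ c * w x) → (xs : List X) →
    length xs * m ≤ c * sumOf w xs
  length*≤*sumOf c w m≤c*w []       = z≤n
  length*≤*sumOf {m = m} c w m≤c*w (x ∷ xs) = begin
    m + length xs * m       ≤⟨ +-mono-≤ (m≤c*w x) (length*≤*sumOf c w m≤c*w xs) ⟩
    c * w x + c * sumOf w xs ≡⟨ *-distribˡ-+ c (w x) (sumOf w xs) ⟨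
    c * (w x + sumOf w xs)   ∎
    where open ≤-Reasoning

  ∃-sumOf≤length*w : (w : X → ℕ) (xs : List X) → 0 < length xs →
    ∃ λ z → z ∈ xs × sumOf w xs ≤ length xs * w z
  ∃-sumOf≤length*w w (x ∷ [])     _ = x , here refl , ≤-refl
  ∃-sumOf≤length*w w (x ∷ y ∷ xs) _ with ∃-sumOf≤length*w w (y ∷ xs) (s≤s z≤n)
  ... | z , z∈ , bound with ≤-total (w x) (w z)
  ...   | inj₁ x≤z = z , there z∈ , +-mono-≤ x≤z bound
  ...   | inj₂ z≤x = x , here refl , +-monoʳ-≤ (w x) (≤-trans bound (*-monoʳ-≤ (length (y ∷ xs)) z≤x))

  0<nCk : k ≤ n → 0 < n C k
  0<nCk {zero}  {n}     k≤n       = s≤s z≤n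
  0<nCk {suc k} {suc n} (s≤s k≤n) =
    <-≤-trans (0<nCk k≤n) (≤-trans (m≤m+n (n C k) (n C suc k)) (≤-reflexive (nCk+nC[k+1]≡[n+1]C[k+1] n k)))

  n≤k+nC[1+k] : ∀ k n → n ≤ k + n C suc k
  n≤k+nC[1+k] k zero    = z≤n
  n≤k+nC[1+k] k (suc n) with k ≤? n
  ... | yes k≤n = begin
    suc n                          ≤⟨ +-monoʳ-≤ 1 (n≤k+nC[1+k] k n) ⟩
    1 + (k + n C suc k)            ≤⟨ +-monoˡ-≤ _ (0<nCk k≤n) ⟩
    n C k + (k + n C suc k)        ≡⟨ x∙yz≈y∙xz (n C k) k _ ⟩
    k + (n C k + n C suc k)        ≡⟨ cong (k +_) (nCk+nC[k+1]≡[n+1]C[k+1] n k) ⟩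
    k + suc n C suc k              ∎
    where open ≤-Reasoning
  ... | no  k≰n = ≤-trans (≰⇒> k≰n) (m≤m+n k _)

  splits : ℕ → List X → List (List X × List X)
  splits zero    xs       = ([] , xs) ∷ []
  splits (suc k) []       = []
  splits (suc k) (x ∷ xs) = map (map₁ (x ∷_)) (splits k xs) ++ map (map₂ (x ∷_)) (splits (suc k) xs)

  splits-↭ : ∀ k (xs : List X) {s r} → (s , r) ∈ splits k xs → (xs ↭ s ++ r) × length s ≡ k
  splits-↭ zero xs (here refl) = ↭-refl , refl
  splits-↭ (suc k) (x ∷ xs) sr∈ with ∈-++⁻ (map (map₁ (x ∷_)) (splits k xs)) sr∈
  ... | inj₁ ∈ˡ with ∈-map⁻ (map₁ (x ∷_)) ∈ˡ
  ...   | (s , r) , sr∈′ , refl = prep x xs↭ , cong suc |s|≡k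
    where open Σ (splits-↭ k xs sr∈′) renaming (proj₁ to xs↭; proj₂ to |s|≡k)
  splits-↭ (suc k) (x ∷ xs) sr∈ | inj₂ ∈ʳ with ∈-map⁻ (map₂ (x ∷_)) ∈ʳ
  ...   | (s , r) , sr∈′ , refl = ↭-trans (prep x xs↭) (↭-sym (shift x s r)) , |s|≡k
    where open Σ (splits-↭ (suc k) xs sr∈′) renaming (proj₁ to xs↭; proj₂ to |s|≡k)

  length-splits : ∀ k (xs : List X) → length (splits k xs) ≡ length xs C k
  length-splits zero    xs       = refl
  length-splits (suc k) []       = refl
  length-splits (suc k) (x ∷ xs) = begin
    length (map (map₁ (x ∷_)) (splits k xs) ++ map (map₂ (x ∷_)) (splits (suc k) xs))
      ≡⟨ length-++ (map (map₁ (x ∷_)) (splits k xs)) ⟩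
    length (map (map₁ (x ∷_)) (splits k xs)) + length (map (map₂ (x ∷_)) (splits (suc k) xs))
      ≡⟨ cong₂ _+_ (length-map _ (splits k xs)) (length-map _ (splits (suc k) xs)) ⟩
    length (splits k xs) + length (splits (suc k) xs)
      ≡⟨ cong₂ _+_ (length-splits k xs) (length-splits (suc k) xs) ⟩
    length xs C k + length xs C suc k
      ≡⟨ nCk+nC[k+1]≡[n+1]C[k+1] (length xs) k ⟩
    suc (length xs) C suc k ∎
    where open ≡-Reasoning

  𝟙 : Bool → ℕ
  𝟙 b = if b then 1 else 0

  count : (X → Bool) → List X → ℕ
  count h = sumOf (λ x → 𝟙 (h x))

  ∣p∣≡𝟙[head]+∣tail∣ : (p : Subset (suc n)) → ∣ p ∣ ≡ 𝟙 (head p) + ∣ tail p ∣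
  ∣p∣≡𝟙[head]+∣tail∣ (true  ∷ᵥ p) = refl
  ∣p∣≡𝟙[head]+∣tail∣ (false ∷ᵥ p) = refl

  ∣p∣≡0 : (p : Subset 0) → ∣ p ∣ ≡ 0
  ∣p∣≡0 []ᵥ = refl

  head-∩ : (p q : Subset (suc n)) → head (p ∩ q) ≡ head p ∧ head q
  head-∩ (b ∷ᵥ p) (c ∷ᵥ q) = refl

  tail-∩ : (p q : Subset (suc n)) → tail (p ∩ q) ≡ tail p ∩ tail q
  tail-∩ (b ∷ᵥ p) (c ∷ᵥ q) = refl

  module _ {X : Set} where

    count-all-splits : (h : X → Bool) → ∀ k (xs : List X) →
      sumOf (𝟙 ∘ all h ∘ proj₁) (splits k xs) ≡ count h xs C k
    count-all-splits h zero    xs       = refl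
    count-all-splits h (suc k) []       = refl
    count-all-splits h (suc k) (x ∷ xs) = begin
      sumOf allH (map (map₁ (x ∷_)) (splits k xs) ++ map (map₂ (x ∷_)) (splits (suc k) xs))
        ≡⟨ sumOf-++ allH (map (map₁ (x ∷_)) (splits k xs)) _ ⟩
      sumOf allH (map (map₁ (x ∷_)) (splits k xs)) + sumOf allH (map (map₂ (x ∷_)) (splits (suc k) xs))
        ≡⟨ cong₂ _+_ (sumOf-map allH (map₁ (x ∷_)) (splits k xs)) (sumOf-map allH (map₂ (x ∷_)) (splits (suc k) xs)) ⟩
      sumOf (allH∧ (h x)) (splits k xs) + sumOf allH (splits (suc k) xs)
        ≡⟨ cong (sumOf (allH∧ (h x)) (splits k xs) +_) (count-all-splits h (suc k) xs) ⟩
      sumOf (allH∧ (h x)) (splits k xs) + count h xs C suc k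
        ≡⟨ pascal (h x) ⟩
      count h (x ∷ xs) C suc k ∎
      where
      open ≡-Reasoning
      allH : List X × List X → ℕ
      allH = 𝟙 ∘ all h ∘ proj₁
      allH∧ : Bool → List X × List X → ℕ
      allH∧ b = 𝟙 ∘ (b ∧_) ∘ all h ∘ proj₁
      pascal : ∀ b → sumOf (allH∧ b) (splits k xs) + count h xs C suc k ≡ (𝟙 b + count h xs) C suc k
      pascal true  = trans (cong (_+ count h xs C suc k) (count-all-splits h k xs))
                           (nCk+nC[k+1]≡[n+1]C[k+1] (count h xs) k)
      pascal false = cong (_+ count h xs C suc k) (sumOf-0 (splits k xs))

    head-⋂ : (f : X → Subset (suc n)) (s : List X) → head (⋂ (map f s)) ≡ all (head ∘ f) s
    head-⋂ f []      = refl
    head-⋂ f (x ∷ s) = trans (head-∩ (f x) _) (cong (head (f x) ∧_) (head-⋂ f s))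

    tail-⋂ : (f : X → Subset (suc n)) (s : List X) → tail (⋂ (map f s)) ≡ ⋂ (map (tail ∘ f) s)
    tail-⋂ f []      = refl
    tail-⋂ f (x ∷ s) = trans (tail-∩ (f x) _) (cong (tail (f x) ∩_) (tail-⋂ f s))

    ∣⋂∣≡𝟙[head]+∣⋂tail∣ : (f : X → Subset (suc n)) (s : List X) →
      ∣ ⋂ (map f s) ∣ ≡ 𝟙 (all (head ∘ f) s) + ∣ ⋂ (map (tail ∘ f) s) ∣
    ∣⋂∣≡𝟙[head]+∣⋂tail∣ f s = begin
      ∣ ⋂ (map f s) ∣                                      ≡⟨ ∣p∣≡𝟙[head]+∣tail∣ (⋂ (map f s)) ⟩
      𝟙 (head (⋂ (map f s))) + ∣ tail (⋂ (map f s)) ∣     ≡⟨ cong₂ (λ b p → 𝟙 b + ∣ p ∣) (head-⋂ f s) (tail-⋂ f s) ⟩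
      𝟙 (all (head ∘ f) s) + ∣ ⋂ (map (tail ∘ f) s) ∣      ∎
      where open ≡-Reasoning

    -- Induction over the points: a point lying in c of the sets contributes c on the left
    -- and C(c, k+1) to the sum on the right, and c ≤ k + C(c, k+1).
    sumOf∣f∣≤k*m+sumOf∣⋂f∣ : ∀ k m (f : X → Subset m) (xs : List X) →
      sumOf (∣_∣ ∘ f) xs ≤ k * m + sumOf (∣_∣ ∘ ⋂ ∘ map f ∘ proj₁) (splits (suc k) xs)
    sumOf∣f∣≤k*m+sumOf∣⋂f∣ k zero f xs =
      ≤-trans (≤-reflexive (trans (sumOf-cong (∣p∣≡0 ∘ f) xs) (sumOf-0 xs))) z≤n
    sumOf∣f∣≤k*m+sumOf∣⋂f∣ k (suc m) f xs = begin
      sumOf (∣_∣ ∘ f) xs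
        ≡⟨ sumOf-cong (∣p∣≡𝟙[head]+∣tail∣ ∘ f) xs ⟩
      sumOf (λ x → 𝟙 (head (f x)) + ∣ tail (f x) ∣) xs
        ≡⟨ sumOf-+ (𝟙 ∘ head ∘ f) (∣_∣ ∘ tail ∘ f) xs ⟩
      c + sumOf (∣_∣ ∘ tail ∘ f) xs
        ≤⟨ +-mono-≤ (n≤k+nC[1+k] k c) (sumOf∣f∣≤k*m+sumOf∣⋂f∣ k m (tail ∘ f) xs) ⟩
      (k + c C suc k) + (k * m + tailSum)
        ≡⟨ interchange k (c C suc k) (k * m) tailSum ⟩
      (k + k * m) + (c C suc k + tailSum)
        ≡⟨ cong₂ _+_ (sym (*-suc k m)) (cong (_+ tailSum) (sym (count-all-splits (head ∘ f) (suc k) xs))) ⟩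
      k * suc m + (sumOf (𝟙 ∘ all (head ∘ f) ∘ proj₁) S + tailSum)
        ≡⟨ cong (k * suc m +_) (sym (sumOf-+ (𝟙 ∘ all (head ∘ f) ∘ proj₁) (∣_∣ ∘ ⋂ ∘ map (tail ∘ f) ∘ proj₁) S)) ⟩
      k * suc m + sumOf (λ (s , _) → 𝟙 (all (head ∘ f) s) + ∣ ⋂ (map (tail ∘ f) s) ∣) S
        ≡⟨ cong (k * suc m +_) (sumOf-cong (λ (s , _) → sym (∣⋂∣≡𝟙[head]+∣⋂tail∣ f s)) S) ⟩
      k * suc m + sumOf (∣_∣ ∘ ⋂ ∘ map f ∘ proj₁) S ∎
      where
      open ≤-Reasoning
      c : ℕ
      c = count (head ∘ f) xs
      S : List (List X × List X)
      S = splits (suc k) xs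
      tailSum : ℕ
      tailSum = sumOf (∣_∣ ∘ ⋂ ∘ map (tail ∘ f) ∘ proj₁) S

    m≤sumOf∣⋂f∣ : ∀ k (f : X → Subset m) (xs : List X) → suc k * m ≤ sumOf (∣_∣ ∘ f) xs →
      m ≤ sumOf (∣_∣ ∘ ⋂ ∘ map f ∘ proj₁) (splits (suc k) xs)
    m≤sumOf∣⋂f∣ {m} k f xs dense = +-cancelˡ-≤ (k * m) m _ (begin
      k * m + m           ≡⟨ +-comm (k * m) m ⟩
      suc k * m           ≤⟨ dense ⟩
      sumOf (∣_∣ ∘ f) xs  ≤⟨ sumOf∣f∣≤k*m+sumOf∣⋂f∣ k m f xs ⟩
      k * m + sumOf (∣_∣ ∘ ⋂ ∘ map f ∘ proj₁) (splits (suc k) xs) ∎)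
      where open ≤-Reasoning

    ∃-large-⋂ : ∀ k (f : X → Subset m) (xs : List X) → suc k ≤ length xs →
      suc k * m ≤ sumOf (∣_∣ ∘ f) xs →
      ∃₂ λ s r → (xs ↭ s ++ r) × length s ≡ suc k × m ≤ (length xs C suc k) * ∣ ⋂ (map f s) ∣
    ∃-large-⋂ k f xs k<|xs| dense
      with ∃-sumOf≤length*w (∣_∣ ∘ ⋂ ∘ map f ∘ proj₁) (splits (suc k) xs)
             (subst (0 <_) (sym (length-splits (suc k) xs)) (0<nCk k<|xs|))
    ... | (s , r) , sr∈ , bound = s , r , xs↭s++r , |s|≡1+k , ≤-trans (m≤sumOf∣⋂f∣ k f xs dense) bound′
      where
      open Σ (splits-↭ (suc k) xs sr∈) renaming (proj₁ to xs↭s++r; proj₂ to |s|≡1+k)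
      bound′ : sumOf (∣_∣ ∘ ⋂ ∘ map f ∘ proj₁) (splits (suc k) xs) ≤ (length xs C suc k) * ∣ ⋂ (map f s) ∣
      bound′ = ≤-trans bound (≤-reflexive (cong (_* ∣ ⋂ (map f s) ∣) (length-splits (suc k) xs)))

  ⋂-quadList : (F : Fin k → Subset m) (q : Quad k) → ⋂ (map F (quadList q)) ≡ quadInter F q
  ⋂-quadList F (a , b , c , d) = cong (λ p → F a ∩ F b ∩ F c ∩ p) (∩-identityʳ (F d))

  length≡4⇒quadList : (s : List (Fin k)) → length s ≡ 4 → ∃ λ q → s ≡ quadList q
  length≡4⇒quadList (a ∷ b ∷ c ∷ d ∷ []) refl = (a , b , c , d) , refl

  ∃-dense-quad : (F : Fin k → Subset m) (b : ℕ) → (∀ i → m ≤ suc b * ∣ F i ∣) →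
    (xs : List (Fin k)) → length xs ≡ suc b * 4 →
    ∃₂ λ q r → (xs ↭ quadList q ++ r) × m ≤ (suc b * 4 C 4) * ∣ quadInter F q ∣
  ∃-dense-quad {m = m} F b large xs |xs|≡ with ∃-large-⋂ 3 F xs (≤-trans (m≤m+n 4 (b * 4)) (≤-reflexive (sym |xs|≡))) dense
    where
    dense : 4 * m ≤ sumOf (∣_∣ ∘ F) xs
    dense = *-cancelˡ-≤ (suc b) (begin
      suc b * (4 * m)              ≡⟨ *-assoc (suc b) 4 m ⟨
      suc b * 4 * m                ≡⟨ cong (_* m) |xs|≡ ⟨
      length xs * m                ≤⟨ length*≤*sumOf (suc b) (∣_∣ ∘ F) large xs ⟩
      suc b * sumOf (∣_∣ ∘ F) xs   ∎)
      where open ≤-Reasoning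
  ... | s , r , xs↭ , |s|≡4 , bound with length≡4⇒quadList s |s|≡4
  ...   | q , refl = q , r , xs↭ , subst₂ (λ N p → m ≤ (N C 4) * ∣ p ∣) |xs|≡ (⋂-quadList F q) bound

module Partition where

  open import Data.Fin using (Fin)
  open import Data.Fin.Subset using (Subset; ∣_∣; _∪_; ⋃; ⁅_⁆; outside; inside) renaming (_∈_ to _∈ₛ_)
  open import Data.Fin.Subset.Properties using (_∈?_; ∣p∣≤∣x∷p∣; ∣⁅x⁆∣≡1; ∣⊥∣≡0; x∈p∪q⁺; x∈p∪q⁻; x∈⁅x⁆; x∈⁅y⁆⇒x≡y; ∉⊥)
  open import Data.List using (List; []; _∷_; _++_; map; length; concatMap; filter; allFin)
  open import Data.List.Properties using (++-assoc; ++-identityʳ; filter-++; filter-all; filter-none)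
  open import Data.List.Membership.Propositional using (_∈_; _∉_)
  open import Data.List.Membership.Propositional.Properties using (∈-++⁺ʳ)
  open import Data.List.Relation.Unary.Any using (here; there)
  open import Data.List.Relation.Unary.All as All using (All; []; _∷_)
  open import Data.List.Relation.Unary.AllPairs using (_∷_)
  open import Data.List.Relation.Unary.Unique.Propositional using (Unique)
  open import Data.List.Relation.Unary.Unique.Propositional.Properties using (allFin⁺)
  open import Data.List.Relation.Binary.Permutation.Propositional
    using (_↭_; ↭-refl; ↭-sym; ↭-trans; prep; ↭⇒↭ₛ; module PermutationReasoning)
  open import Data.List.Relation.Binary.Permutation.Propositional.Properties
    using (shift; shifts; ++⁺ˡ; ↭-length; filter-↭)
  open import Data.Nat using (ℕ; suc; _+_; _≤_; z≤n; s≤s; _≟_)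
  open import Data.Nat.Properties using (≤-trans; ≤-reflexive; +-monoʳ-≤; +-suc; ≤∧≢⇒<; suc-injective; m≤n+m; module ≤-Reasoning)
  open import Data.Product using (Σ; ∃₂; _×_; _,_)
  open import Data.Sum using (inj₁; inj₂)
  open import Data.Vec using () renaming ([] to []ᵥ; _∷_ to _∷ᵥ_)
  open import Relation.Binary.PropositionalEquality
  open import Relation.Nullary using (yes; no; ¬_; ¬?; contradiction)
  open import Relation.Unary using (Decidable)

  private variable
    n : ℕ

  ∣p∪q∣≤∣p∣+∣q∣ : (p q : Subset n) → ∣ p ∪ q ∣ ≤ ∣ p ∣ + ∣ q ∣
  ∣p∪q∣≤∣p∣+∣q∣ []ᵥ      []ᵥ      = z≤n
  ∣p∪q∣≤∣p∣+∣q∣ (inside  ∷ᵥ p) (b ∷ᵥ q)       = s≤s (≤-trans (∣p∪q∣≤∣p∣+∣q∣ p q) (+-monoʳ-≤ ∣ p ∣ (∣p∣≤∣x∷p∣ b q)))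
  ∣p∪q∣≤∣p∣+∣q∣ (outside ∷ᵥ p) (inside  ∷ᵥ q) = ≤-trans (s≤s (∣p∪q∣≤∣p∣+∣q∣ p q)) (≤-reflexive (sym (+-suc ∣ p ∣ ∣ q ∣)))
  ∣p∪q∣≤∣p∣+∣q∣ (outside ∷ᵥ p) (outside ∷ᵥ q) = ∣p∪q∣≤∣p∣+∣q∣ p q

  ∣⋃⁅xs⁆∣≤length : (xs : List (Fin n)) → ∣ ⋃ (map ⁅_⁆ xs) ∣ ≤ length xs
  ∣⋃⁅xs⁆∣≤length {n} []       = ≤-reflexive (∣⊥∣≡0 n)
  ∣⋃⁅xs⁆∣≤length     (x ∷ xs) = begin
    ∣ ⁅ x ⁆ ∪ ⋃ (map ⁅_⁆ xs) ∣      ≤⟨ ∣p∪q∣≤∣p∣+∣q∣ ⁅ x ⁆ _ ⟩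
    ∣ ⁅ x ⁆ ∣ + ∣ ⋃ (map ⁅_⁆ xs) ∣  ≡⟨ cong (_+ _) (∣⁅x⁆∣≡1 x) ⟩
    suc ∣ ⋃ (map ⁅_⁆ xs) ∣          ≤⟨ s≤s (∣⋃⁅xs⁆∣≤length xs) ⟩
    suc (length xs)                  ∎
    where open ≤-Reasoning

  ∈⇒∈⋃⁅⁆ : {i : Fin n} (xs : List (Fin n)) → i ∈ xs → i ∈ₛ ⋃ (map ⁅_⁆ xs)
  ∈⇒∈⋃⁅⁆ (x ∷ xs) (here refl) = x∈p∪q⁺ (inj₁ (x∈⁅x⁆ x))
  ∈⇒∈⋃⁅⁆ (x ∷ xs) (there i∈) = x∈p∪q⁺ (inj₂ (∈⇒∈⋃⁅⁆ xs i∈))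

  ∈⋃⁅⁆⇒∈ : {i : Fin n} (xs : List (Fin n)) → i ∈ₛ ⋃ (map ⁅_⁆ xs) → i ∈ xs
  ∈⋃⁅⁆⇒∈ []       i∈ = contradiction i∈ ∉⊥
  ∈⋃⁅⁆⇒∈ (x ∷ xs) i∈ with x∈p∪q⁻ ⁅ x ⁆ _ i∈
  ... | inj₁ i∈⁅x⁆ = here (x∈⁅y⁆⇒x≡y x i∈⁅x⁆)
  ... | inj₂ i∈⋃  = there (∈⋃⁅⁆⇒∈ xs i∈⋃)

  Unique-++⇒∉ : {A : Set} (xs : List A) {ys : List A} {x : A} → Unique (xs ++ ys) → x ∈ xs → x ∉ ys
  Unique-++⇒∉ (y ∷ xs) (y∉ ∷ _) (here refl) x∈ys = All.lookup y∉ (∈-++⁺ʳ xs x∈ys) refl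
  Unique-++⇒∉ (y ∷ xs) (_ ∷ u)  (there x∈)  = Unique-++⇒∉ xs u x∈

  rest-⋃⁅⁆ : {Z R : List (Fin n)} → allFin n ↭ Z ++ R → rest (⋃ (map ⁅_⁆ R)) ↭ Z
  rest-⋃⁅⁆ {n} {Z} {R} allFin↭ = begin
    filter ∉G? (allFin n)         ↭⟨ filter-↭ ∉G? allFin↭ ⟩
    filter ∉G? (Z ++ R)           ≡⟨ filter-++ ∉G? Z R ⟩
    filter ∉G? Z ++ filter ∉G? R  ≡⟨ cong₂ _++_ (filter-all ∉G? Z∉G) (filter-none ∉G? R⊆G) ⟩
    Z ++ []                       ≡⟨ ++-identityʳ Z ⟩
    Z                             ∎
    where
    open PermutationReasoning
    open import Data.List.Relation.Binary.Permutation.Setoid.Properties (setoid (Fin n)) using (Unique-resp-↭)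
    G : Subset n
    G = ⋃ (map ⁅_⁆ R)
    ∉G? : Decidable (λ i → ¬ i ∈ₛ G)
    ∉G? i = ¬? (i ∈? G)
    Z∉G : All (λ i → ¬ i ∈ₛ G) Z
    Z∉G = All.tabulate λ i∈Z i∈G →
      Unique-++⇒∉ Z (Unique-resp-↭ (↭⇒↭ₛ allFin↭) (allFin⁺ n)) i∈Z (∈⋃⁅⁆⇒∈ R i∈G)
    R⊆G : All (λ i → ¬ ¬ i ∈ₛ G) R
    R⊆G = All.tabulate λ i∈R i∉G → i∉G (∈⇒∈⋃⁅⁆ R i∈R)

  module _ {k : ℕ} (Good : Quad k → Set) (C : ℕ)
           (good-quad : (xs : List (Fin k)) → length xs ≡ suc C →
                        ∃₂ λ q r → (xs ↭ quadList q ++ r) × Good q) where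

    -- The leftover list grows one element at a time; once it would exceed C elements,
    -- a Good quadruple is taken out of it.
    greedy-quads : (xs : List (Fin k)) →
      ∃₂ λ P R → (xs ↭ concatMap quadList P ++ R) × length R ≤ C × All Good P
    greedy-quads []       = [] , [] , ↭-refl , z≤n , []
    greedy-quads (x ∷ xs) with greedy-quads xs
    ... | P , R , xs↭ , |R|≤C , good with length R ≟ C
    ...   | no |R|≢C = P , x ∷ R , ↭-trans (prep x xs↭) (↭-sym (shift x Z R)) , ≤∧≢⇒< |R|≤C |R|≢C , good
      where
      Z : List (Fin k)
      Z = concatMap quadList P
    ...   | yes |R|≡C with good-quad (x ∷ R) (cong suc |R|≡C)
    ...     | q , r , xR↭ , good-q = q ∷ P , r , x∷xs↭ , |r|≤C , good-q ∷ good
      where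
      Z : List (Fin k)
      Z = concatMap quadList P
      x∷xs↭ : x ∷ xs ↭ (quadList q ++ Z) ++ r
      x∷xs↭ = begin
        x ∷ xs                  ↭⟨ prep x xs↭ ⟩
        x ∷ Z ++ R              ↭⟨ shift x Z R ⟨
        Z ++ x ∷ R              ↭⟨ ++⁺ˡ Z xR↭ ⟩
        Z ++ quadList q ++ r    ↭⟨ shifts Z (quadList q) ⟩
        quadList q ++ Z ++ r    ≡⟨ ++-assoc (quadList q) Z r ⟨
        (quadList q ++ Z) ++ r  ∎
        where open PermutationReasoning
      |r|≤C : length r ≤ C
      |r|≤C = subst (length r ≤_) (suc-injective (trans (sym (↭-length xR↭)) (cong suc |R|≡C))) (m≤n+m (length r) 3)

    quad-partition : Σ (Subset k) λ G → ∣ G ∣ ≤ C ×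
      Σ (List (Quad k)) λ P → IsQuadPartition G P × All Good P
    quad-partition with greedy-quads (allFin k)
    ... | P , R , allFin↭ , |R|≤C , good =
      ⋃ (map ⁅_⁆ R) , ≤-trans (∣⋃⁅xs⁆∣≤length R) |R|≤C , P , ↭-sym (rest-⋃⁅⁆ allFin↭) , good

open import Data.Fin using (Fin)
open import Data.Fin.Subset using (Subset; ∣_∣)
open import Data.Integer as ℤ using (+_)
import Data.Integer.Properties as ℤ
open import Data.List using (List; length; _++_)
open import Data.List.Relation.Unary.All using (All)
open import Data.List.Relation.Binary.Permutation.Propositional using (_↭_)
open import Data.Nat as ℕ using (ℕ; suc) renaming (_≤_ to _≤ℕ_)
import Data.Nat.Properties as ℕ
open import Data.Nat.Combinatorics using (_C_)
open import Data.Nat.Coprimality using (Coprime; 1-coprimeTo) renaming (sym to coprime-sym)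
open import Data.Product using (Σ; ∃₂; _×_; _,_)
open import Data.Rational using (ℚ; mkℚ; Positive; _*_; _≤_)
open import Data.Rational.Properties using (normalize-coprime; toℚᵘ-mono-≤; toℚᵘ-cancel-≤; toℚᵘ-homo-*)
import Data.Rational.Unnormalised as ℚᵘ
import Data.Rational.Unnormalised.Properties as ℚᵘ
open import Function.Bundles using (_⇔_; mk⇔; Equivalence)
open import Function.Definitions using (Injective)
open import Relation.Binary.PropositionalEquality using (_≡_; sym; trans; cong; subst₂)

open Counting using (∃-dense-quad)
open Partition using (quad-partition)

ℕtoℚ≡mkℚ : ∀ m → ℕtoℚ m ≡ mkℚ (+ m) 0 (coprime-sym (1-coprimeTo m))
ℕtoℚ≡mkℚ m = normalize-coprime (coprime-sym (1-coprimeTo m))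

mkℚ*ℕtoℚ≤ℕtoℚ⇔ : ∀ n d .(c : Coprime n (suc d)) m x →
  (mkℚ (+ n) d c * ℕtoℚ m ≤ ℕtoℚ x) ⇔ (n ℕ.* m ≤ℕ suc d ℕ.* x)
mkℚ*ℕtoℚ≤ℕtoℚ⇔ n d c m x rewrite ℕtoℚ≡mkℚ m | ℕtoℚ≡mkℚ x = mk⇔ to from
  where
  p M X : ℚ
  p = mkℚ (+ n) d c
  M = mkℚ (+ m) 0 (coprime-sym (1-coprimeTo m))
  X = mkℚ (+ x) 0 (coprime-sym (1-coprimeTo x))
  lhs : (+ n ℤ.* + m) ℤ.* + 1 ≡ + (n ℕ.* m)
  lhs = trans (ℤ.*-identityʳ _) (sym (ℤ.pos-* n m))
  rhs : + x ℤ.* + (suc d ℕ.* 1) ≡ + (suc d ℕ.* x)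
  rhs = trans (sym (ℤ.pos-* x _)) (cong +_ (trans (cong (x ℕ.*_) (ℕ.*-identityʳ (suc d))) (ℕ.*-comm x (suc d))))
  to : p * M ≤ X → n ℕ.* m ≤ℕ suc d ℕ.* x
  to pM≤X with ℚᵘ.≤-respˡ-≃ (toℚᵘ-homo-* p M) (toℚᵘ-mono-≤ pM≤X)
  ... | ℚᵘ.*≤* le = ℤ.drop‿+≤+ (subst₂ ℤ._≤_ lhs rhs le)
  from : n ℕ.* m ≤ℕ suc d ℕ.* x → p * M ≤ X
  from le = toℚᵘ-cancel-≤ (ℚᵘ.≤-respˡ-≃ (ℚᵘ.≃-sym (toℚᵘ-homo-* p M))
    (ℚᵘ.*≤* (subst₂ ℤ._≤_ (sym lhs) (sym rhs) (ℤ.+≤+ le))))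

lemma2p12 : (ε : ℚ) → Positive ε →
  Σ ℚ λ δ → Positive δ × Σ ℕ λ C →
    (m k : ℕ) (F : Fin k → Subset m) → Injective _≡_ _≡_ F →
    (∀ i → ε * ℕtoℚ m ≤ ℕtoℚ ∣ F i ∣) →
    Σ (Subset k) λ G → ∣ G ∣ ≤ℕ C ×
      Σ (List (Quad k)) λ P → IsQuadPartition G P ×
        All (λ q → δ * ℕtoℚ m ≤ ℕtoℚ ∣ quadInter F q ∣) P
lemma2p12 (mkℚ (+ suc a) b c) _ = δ , _ , K , λ m k F _ εm≤∣F∣ →
  quad-partition (λ q → δ * ℕtoℚ m ≤ ℕtoℚ ∣ quadInter F q ∣) K (good-quad F εm≤∣F∣)
  where
  K D : ℕ
  K = 3 ℕ.+ b ℕ.* 4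
  D = suc K C 4
  δ : ℚ
  δ = mkℚ (+ 1) D (1-coprimeTo (suc D))
  good-quad : ∀ {m k} (F : Fin k → Subset m) → (∀ i → mkℚ (+ suc a) b c * ℕtoℚ m ≤ ℕtoℚ ∣ F i ∣) →
    (xs : List (Fin k)) → length xs ≡ suc K →
    ∃₂ λ q r → (xs ↭ quadList q ++ r) × δ * ℕtoℚ m ≤ ℕtoℚ ∣ quadInter F q ∣
  good-quad {m} F εm≤∣F∣ xs |xs|≡ with ∃-dense-quad F b m≤[1+b]∣F∣ xs |xs|≡
    where
    m≤[1+b]∣F∣ : ∀ i → m ≤ℕ suc b ℕ.* ∣ F i ∣
    m≤[1+b]∣F∣ i = ℕ.≤-trans (ℕ.m≤m+n m (a ℕ.* m))
                     (Equivalence.to (mkℚ*ℕtoℚ≤ℕtoℚ⇔ (suc a) b c m ∣ F i ∣) (εm≤∣F∣ i))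
  ... | q , r , xs↭ , m≤D∣q∣ = q , r , xs↭ ,
    Equivalence.from (mkℚ*ℕtoℚ≤ℕtoℚ⇔ 1 D _ m ∣ quadInter F q ∣)
      (ℕ.≤-trans (ℕ.≤-reflexive (ℕ.*-identityˡ m)) (ℕ.≤-trans m≤D∣q∣ (ℕ.m≤n+m _ ∣ quadInter F q ∣)))
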